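{- Let $G$ be a graph and let $A_1,A_2,B$ be pairwise disjoint non-empty subsets of $V(G)$. Suppose that for each $i\in\{1,2\}$ there exists a set $\mathcal{P}_i$ of $A_i$–$B$ paths in $G\setminus A_{3-i}$ with $|\mathcal{P}_i|=2|A_i|$, such that the paths of $\mathcal{P}_i$ are pairwise vertex-disjoint in $G\setminus A_i$ (i.e. they share no vertices outside $A_i$) and every vertex of $A_i$ lies in exactly two paths of $\mathcal{P}_i$. Then there exist $|A_1|+|A_2|$ pairwise vertex-disjoint $(A_1\cup A_2)$–$B$ paths in $G$.
   Context: All graphs are finite and simple. For $A,B\subseteq V(G)$, a path $P=v_1\dots v_k$ in $G$ is an $A$–$B$ path if $V(P)\cap A=\{v_1\}$ and $V(P)\cap B=\{v_k\}$. For $X\subseteq V(G)$, $G\setminus X$ is the graph obtained by deleting $X$. -}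

module Defs where

open import Data.Nat using (ℕ; _+_; _*_)
open import Data.Bool using (Bool; T)
open import Data.Fin using (Fin)
open import Data.Fin.Subset using (Subset; _∈_; _∉_; ∣_∣; Nonempty)
open import Data.List.NonEmpty using (List⁺; toList; head; last)
open import Data.List.Relation.Unary.Unique.Propositional using (Unique)
open import Data.List.Relation.Unary.Linked using (Linked)
import Data.List.Membership.Propositional as LM
open import Data.Product using (Σ; ∃; ∃-syntax; _×_; _,_)
open import Data.Sum using (_⊎_)
open import Relation.Binary.PropositionalEquality using (_≡_; _≢_)
open import Relation.Nullary using (¬_)

record Graph (n : ℕ) : Set where
  field
    edge   : Fin n → Fin n → Bool
    sym    : ∀ u v → edge u v ≡ edge v u
    irrefl : ∀ v → edge v v ≡ Data.Bool.false

open Graph public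

Adj : ∀ {n} → Graph n → Fin n → Fin n → Set
Adj G u v = T (edge G u v)

IsPath : ∀ {n} → Graph n → List⁺ (Fin n) → Set
IsPath G p = Unique (toList p) × Linked (Adj G) (toList p)

_∈P_ : ∀ {n} → Fin n → List⁺ (Fin n) → Set
x ∈P p = x LM.∈ toList p

IsABPath : ∀ {n} → Graph n → Subset n → Subset n → List⁺ (Fin n) → Set
IsABPath G A B p =
  IsPath G p × head p ∈ A × last p ∈ B
  × (∀ x → x ∈P p → x ∈ A → x ≡ head p)
  × (∀ x → x ∈P p → x ∈ B → x ≡ last p)

Avoids : ∀ {n} → Subset n → List⁺ (Fin n) → Set
Avoids X p = ∀ x → x ∈P p → x ∉ X

Disjoint : ∀ {n} → Subset n → Subset n → Set
Disjoint A B = ∀ x → x ∈ A → x ∉ B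

GoodFamily : ∀ {n} → Graph n → (A C B : Subset n) → Set
GoodFamily {n} G A C B =
  Σ (Fin (2 * ∣ A ∣) → List⁺ (Fin n)) λ P →
    (∀ j → IsABPath G A B (P j) × Avoids C (P j))
    × (∀ j k → j ≢ k → ∀ x → x ∈P P j → x ∈P P k → x ∈ A)
    × (∀ a → a ∈ A → Σ (Fin (2 * ∣ A ∣)) λ j → Σ (Fin (2 * ∣ A ∣)) λ k →
         j ≢ k × a ∈P P j × a ∈P P k × (∀ l → a ∈P P l → l ≡ j ⊎ l ≡ k))

{-# OPTIONS --safe #-}
-- By Menger's theorem it suffices that every (A₁ ∪ A₂)–B separator X has at least
-- |A₁| + |A₂| vertices. Each of the 2|A₁| + 2|A₂| paths of 𝒫₁ ∪ 𝒫₂ meets X, and no vertex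
-- lies on three of them: a vertex shared by two paths of 𝒫ᵢ lies in Aᵢ, so it is on
-- exactly two paths of 𝒫ᵢ and, as 𝒫₃₋ᵢ avoids Aᵢ, on none of 𝒫₃₋ᵢ. Hence
-- 2(|A₁| + |A₂|) ≤ 2|X|.
--
-- Menger's theorem is proved by induction on the number of edges. Delete an edge xy. If
-- G − xy has no separator smaller than k we are done. Otherwise such a separator S has x
-- and y on different sides, and G − xy contains k disjoint paths from A to S + y and k
-- from S + x to B, since every separator of these is an A–B separator of G; the two
-- linkages glue along S and the edge yx.
module Submission where

open import Defs
open import Data.Bool using (Bool; true; false; T; T?; _∧_; not; if_then_else_)
import Data.Bool.Properties as Bool
open import Data.Empty using (⊥; ⊥-elim)
open import Data.Fin using (Fin; zero; suc; punchIn; splitAt; join; inject≤)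
import Data.Fin.Properties as Fin
open import Data.Fin.Subset using (Subset; _∈_; _∉_; ∣_∣; _∪_; _∩_; _-_; ∁; ⁅_⁆; Nonempty; inside; outside)
open import Data.Fin.Subset.Properties
  using (_∈?_; anySubset?; x∈p∪q⁺; x∈p∪q⁻; x∈p∩q⁺; x∈p∩q⁻; x∈∁p⇒x∉p; x∉p⇒x∈∁p;
         x∈⁅x⁆; x∈⁅y⁆⇒x≡y; ∣⁅x⁆∣≡1; x∈p∧x≢y⇒x∈p-y; x∈p⇒∣p-x∣<∣p∣)
open import Data.List using (List; []; _∷_; _++_; _∷ʳ_; initLast; _∷ʳ′_)
open import Data.List.NonEmpty using (List⁺; _∷_; head; tail; last; toList; _⁺++_)
open import Data.List.Membership.Propositional using () renaming (_∈_ to _∈ₗ_)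
open import Data.List.Membership.Propositional.Properties using (∈-++⁻)
open import Data.List.Relation.Unary.Any using (here; there)
open import Data.List.Relation.Unary.Linked using (Linked; []; [-]; _∷_)
import Data.List.Relation.Unary.Linked as Linked
open import Data.List.Relation.Unary.All using ([])
open import Data.List.Relation.Unary.AllPairs using ([]; _∷_)
import Data.List.Relation.Unary.AllPairs as AllPairs
open import Data.List.Relation.Unary.Unique.Propositional using (Unique)
open import Data.List.Relation.Unary.Unique.Propositional.Properties using (Unique[x∷xs]⇒x∉xs; ++⁺)
open import Data.Nat using (ℕ; zero; suc; _+_; _*_; _≤_; _<_; z≤n; s≤s; _≤?_)
import Data.Nat.Properties as ℕ
open import Data.Product using (Σ; ∃; _×_; _,_; proj₁; proj₂; swap)
open import Data.Sum using (_⊎_; inj₁; inj₂; [_,_]′)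
import Data.Sum as Sum
open import Data.Vec using ([]; _∷_; here; there)
open import Function using (_∘_; id)
open import Function.Bundles using (Equivalence)
open import Function.Definitions using (Injective)
open import Relation.Binary.PropositionalEquality using (_≡_; _≢_; refl; cong; subst; subst₂)
import Relation.Binary.PropositionalEquality as ≡
open import Relation.Nullary using (¬_; Dec; yes; no)
open import Relation.Nullary.Decidable using (⌊_⌋; toSum; _×-dec_; _⊎-dec_; _→-dec_; ¬?; map′)

-- The library's `last` goes through `initLast` and does not reduce on x ∷ y ∷ ys;
-- `end x xs` is the same vertex computed structurally (see last≡end).
end : {A : Set} → A → List A → A
end x []       = x
end _ (y ∷ ys) = end y ys

end-∷ʳ : {A : Set} (x : A) (ys : List A) (y : A) → end x (ys ∷ʳ y) ≡ y
end-∷ʳ x []       y = refl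
end-∷ʳ _ (z ∷ zs) y = end-∷ʳ z zs y

last≡end : {A : Set} (x : A) (xs : List A) → last (x ∷ xs) ≡ end x xs
last≡end x xs with initLast xs
... | []       = refl
... | ys ∷ʳ′ y = ≡.sym (end-∷ʳ x ys y)

end∈ : {A : Set} (x : A) (xs : List A) → end x xs ∈ₗ x ∷ xs
end∈ x []       = here refl
end∈ _ (y ∷ ys) = there (end∈ y ys)

end-++ : {A : Set} (x : A) (xs ys : List A) → end x (xs ++ ys) ≡ end (end x xs) ys
end-++ x []       ys = refl
end-++ _ (y ∷ xs) ys = end-++ y xs ys

last∈P : ∀ {n} (p : List⁺ (Fin n)) → last p ∈P p
last∈P (x ∷ xs) = subst (_∈ₗ x ∷ xs) (≡.sym (last≡end x xs)) (end∈ x xs)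

Linked-++ : {A : Set} {R : A → A → Set} (x : A) (xs ys : List A) →
  Linked R (x ∷ xs) → Linked R (end x xs ∷ ys) → Linked R (x ∷ xs ++ ys)
Linked-++ x []       ys _          end-ys = end-ys
Linked-++ x (y ∷ xs) ys (xy ∷ lk) end-ys = xy ∷ Linked-++ y xs ys lk end-ys

-- Counting vertices of finite subsets

injective⇒≤∣p∣ : ∀ {m n} (p : Subset n) (f : Fin m → Fin n) →
  Injective _≡_ _≡_ f → (∀ i → f i ∈ p) → m ≤ ∣ p ∣
injective⇒≤∣p∣ {zero}  p f _   _   = z≤n
injective⇒≤∣p∣ {suc m} p f inj f∈p =
  ℕ.≤-trans (s≤s (injective⇒≤∣p∣ (p - f zero) (f ∘ suc) (Fin.suc-injective ∘ inj) f[1+i]∈p-f₀))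
            (x∈p⇒∣p-x∣<∣p∣ (f∈p zero))
  where
  f[1+i]∈p-f₀ : ∀ i → f (suc i) ∈ p - f zero
  f[1+i]∈p-f₀ i = x∈p∧x≢y⇒x∈p-y (f∈p (suc i)) (Fin.0≢1+n ∘ ≡.sym ∘ inj)

enumerate : ∀ {n} (p : Subset n) →
  Σ (Fin ∣ p ∣ → Fin n) λ f → Injective _≡_ _≡_ f × (∀ i → f i ∈ p)
enumerate []            = (λ ()) , (λ {}) , (λ ())
enumerate (outside ∷ p) with enumerate p
... | f , inj , f∈p = suc ∘ f , inj ∘ Fin.suc-injective , λ i → there (f∈p i)
enumerate {suc n} (inside ∷ p) with enumerate p
... | f , inj , f∈p = g , g-injective , g∈p
  where
  g : Fin (suc ∣ p ∣) → Fin (suc n)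
  g zero    = zero
  g (suc i) = suc (f i)
  g-injective : Injective _≡_ _≡_ g
  g-injective {zero}  {zero}  _ = refl
  g-injective {suc i} {suc j} e = cong suc (inj (Fin.suc-injective e))
  g∈p : ∀ i → g i ∈ inside ∷ p
  g∈p zero    = here
  g∈p (suc i) = there (f∈p i)

∣p∪q∣≤∣p∣+∣q∣ : ∀ {n} (p q : Subset n) → ∣ p ∪ q ∣ ≤ ∣ p ∣ + ∣ q ∣
∣p∪q∣≤∣p∣+∣q∣ []            []            = z≤n
∣p∪q∣≤∣p∣+∣q∣ (inside ∷ p)  (inside ∷ q)  = s≤s (ℕ.≤-trans (∣p∪q∣≤∣p∣+∣q∣ p q) (ℕ.+-monoʳ-≤ ∣ p ∣ (ℕ.n≤1+n _)))
∣p∪q∣≤∣p∣+∣q∣ (inside ∷ p)  (outside ∷ q) = s≤s (∣p∪q∣≤∣p∣+∣q∣ p q)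
∣p∪q∣≤∣p∣+∣q∣ (outside ∷ p) (inside ∷ q)  = ℕ.≤-trans (s≤s (∣p∪q∣≤∣p∣+∣q∣ p q)) (ℕ.≤-reflexive (≡.sym (ℕ.+-suc ∣ p ∣ ∣ q ∣)))
∣p∪q∣≤∣p∣+∣q∣ (outside ∷ p) (outside ∷ q) = ∣p∪q∣≤∣p∣+∣q∣ p q

injective⇒onto : ∀ {k n} (p : Subset n) (f : Fin k → Fin n) →
  Injective _≡_ _≡_ f → (∀ i → f i ∈ p) → ∣ p ∣ ≤ k → ∀ {v} → v ∈ p → ∃ λ i → f i ≡ v
injective⇒onto p f inj f∈p ∣p∣≤k {v} v∈p with Fin.any? (λ i → f i Fin.≟ v)
... | yes hit = hit
... | no miss = ⊥-elim (ℕ.<-irrefl refl (ℕ.<-≤-trans (x∈p⇒∣p-x∣<∣p∣ v∈p) ∣p∣≤∣p-v∣))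
  where
  ∣p∣≤∣p-v∣ : ∣ p ∣ ≤ ∣ p - v ∣
  ∣p∣≤∣p-v∣ = ℕ.≤-trans ∣p∣≤k (injective⇒≤∣p∣ (p - v) f inj λ i → x∈p∧x≢y⇒x∈p-y (f∈p i) (miss ∘ (i ,_)))

+-double-mono : ∀ {m x y} → x < y → m ≤ x + x → 2 + m ≤ y + y
+-double-mono {m} {x} x<y m≤2x = ℕ.≤-trans (s≤s (s≤s m≤2x))
  (ℕ.≤-trans (ℕ.≤-reflexive (cong suc (≡.sym (ℕ.+-suc x x)))) (ℕ.+-mono-≤ x<y x<y))

AtMostTwoToOne : ∀ {m n} → (Fin m → Fin n) → Set
AtMostTwoToOne f = ∀ {i j l} → i ≢ j → j ≢ l → i ≢ l → f i ≡ f j → f j ≡ f l → ⊥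

atMostTwoToOne⇒≤2∣p∣ : ∀ {m n} (p : Subset n) (f : Fin m → Fin n) →
  AtMostTwoToOne f → (∀ i → f i ∈ p) → m ≤ ∣ p ∣ + ∣ p ∣
atMostTwoToOne⇒≤2∣p∣ {zero} p f _ _ = z≤n
atMostTwoToOne⇒≤2∣p∣ {suc m} p f two f∈p with Fin.any? (λ i → f (suc i) Fin.≟ f zero)
... | no single = ℕ.≤-trans (ℕ.n≤1+n _) (+-double-mono (x∈p⇒∣p-x∣<∣p∣ (f∈p zero))
      (atMostTwoToOne⇒≤2∣p∣ (p - f zero) (f ∘ suc) two∘suc
        λ i → x∈p∧x≢y⇒x∈p-y (f∈p (suc i)) (single ∘ (i ,_))))
  where
  two∘suc : AtMostTwoToOne (f ∘ suc)
  two∘suc i≢j j≢l i≢l = two (i≢j ∘ Fin.suc-injective) (j≢l ∘ Fin.suc-injective) (i≢l ∘ Fin.suc-injective)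
atMostTwoToOne⇒≤2∣p∣ {suc zero} p f two f∈p | yes (() , _)
atMostTwoToOne⇒≤2∣p∣ {suc (suc m)} {n} p f two f∈p | yes (i₀ , f[1+i₀]≡f₀) =
  +-double-mono (x∈p⇒∣p-x∣<∣p∣ (f∈p zero)) (atMostTwoToOne⇒≤2∣p∣ (p - f zero) g two∘g g∈p-f₀)
  where
  g : Fin m → Fin n
  g j = f (suc (punchIn i₀ j))
  1+punchIn-injective : ∀ {j l} → j ≢ l → suc (punchIn i₀ j) ≢ suc (punchIn i₀ l)
  1+punchIn-injective j≢l = j≢l ∘ Fin.punchIn-injective i₀ _ _ ∘ Fin.suc-injective
  two∘g : AtMostTwoToOne g
  two∘g i≢j j≢l i≢l = two (1+punchIn-injective i≢j) (1+punchIn-injective j≢l) (1+punchIn-injective i≢l)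
  g∈p-f₀ : ∀ j → g j ∈ p - f zero
  g∈p-f₀ j = x∈p∧x≢y⇒x∈p-y (f∈p _) λ gj≡f₀ →
    two (λ ()) (Fin.punchInᵢ≢i i₀ j ∘ ≡.sym ∘ Fin.suc-injective) (λ ())
        (≡.sym f[1+i₀]≡f₀) (≡.trans f[1+i₀]≡f₀ (≡.sym gj≡f₀))

-- Menger's theorem

_⊆ᴳ_ : ∀ {n} → Graph n → Graph n → Set
H ⊆ᴳ G = ∀ {u v} → Adj H u v → Adj G u v

SameEnds : ∀ {n} → Fin n → Fin n → Fin n → Fin n → Set
SameEnds u v x y = (u ≡ x × v ≡ y) ⊎ (u ≡ y × v ≡ x)

sameEnds? : ∀ {n} (u v x y : Fin n) → Dec (SameEnds u v x y)
sameEnds? u v x y = ((u Fin.≟ x) ×-dec (v Fin.≟ y)) ⊎-dec ((u Fin.≟ y) ×-dec (v Fin.≟ x))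

sameEnds-swap : ∀ {n} {u v x y : Fin n} → SameEnds u v x y → SameEnds v u x y
sameEnds-swap = Sum.swap ∘ Sum.map swap swap

sameEnds?-sym : ∀ {n} (u v x y : Fin n) → ⌊ sameEnds? u v x y ⌋ ≡ ⌊ sameEnds? v u x y ⌋
sameEnds?-sym u v x y with sameEnds? u v x y | sameEnds? v u x y
... | yes _  | yes _  = refl
... | no _   | no _   = refl
... | yes uv | no ¬vu = ⊥-elim (¬vu (sameEnds-swap uv))
... | no ¬uv | yes vu = ⊥-elim (¬uv (sameEnds-swap vu))

removeEdge : ∀ {n} → Graph n → Fin n → Fin n → Graph n
removeEdge G x y = record
  { edge   = λ u v → edge G u v ∧ not ⌊ sameEnds? u v x y ⌋
  ; sym    = λ u v → ≡.cong₂ _∧_ (Graph.sym G u v) (cong not (sameEnds?-sym u v x y))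
  ; irrefl = λ v → cong (_∧ not ⌊ sameEnds? v v x y ⌋) (irrefl G v)
  }

removeEdge-⊆ : ∀ {n} (G : Graph n) x y → removeEdge G x y ⊆ᴳ G
removeEdge-⊆ G x y uv = proj₁ (Equivalence.to Bool.T-∧ uv)

adj⇒adj-removeEdge⊎sameEnds : ∀ {n} (G : Graph n) x y {u v} →
  Adj G u v → Adj (removeEdge G x y) u v ⊎ SameEnds u v x y
adj⇒adj-removeEdge⊎sameEnds G x y {u} {v} uv with sameEnds? u v x y
... | yes same = inj₂ same
... | no _     = inj₁ (Equivalence.from Bool.T-∧ (uv , _))

sumFin : ∀ {n} → (Fin n → ℕ) → ℕ
sumFin {zero}  f = 0
sumFin {suc n} f = f zero + sumFin (f ∘ suc)

sumFin-mono-≤ : ∀ {n} {f g : Fin n → ℕ} → (∀ i → f i ≤ g i) → sumFin f ≤ sumFin g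
sumFin-mono-≤ {zero}  f≤g = z≤n
sumFin-mono-≤ {suc n} f≤g = ℕ.+-mono-≤ (f≤g zero) (sumFin-mono-≤ (f≤g ∘ suc))

sumFin-mono-< : ∀ {n} {f g : Fin n → ℕ} → (∀ i → f i ≤ g i) → ∀ j → f j < g j → sumFin f < sumFin g
sumFin-mono-< f≤g zero    fj<gj = ℕ.+-mono-<-≤ fj<gj (sumFin-mono-≤ (f≤g ∘ suc))
sumFin-mono-< f≤g (suc j) fj<gj = ℕ.+-mono-≤-< (f≤g zero) (sumFin-mono-< (f≤g ∘ suc) j fj<gj)

indicator : Bool → ℕ
indicator b = if b then 1 else 0

indicator-∧ : ∀ a b → indicator (a ∧ b) ≤ indicator a
indicator-∧ true  true  = ℕ.≤-refl
indicator-∧ true  false = z≤n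
indicator-∧ false _     = z≤n

edgeCount : ∀ {n} → Graph n → ℕ
edgeCount G = sumFin λ u → sumFin λ v → indicator (edge G u v)

edgeCount-removeEdge : ∀ {n} (G : Graph n) x y → Adj G x y → edgeCount (removeEdge G x y) < edgeCount G
edgeCount-removeEdge G x y xy =
  sumFin-mono-< (λ u → sumFin-mono-≤ λ v → indicator-∧ (edge G u v) _) x
    (sumFin-mono-< (λ v → indicator-∧ (edge G x v) _) y (xy-removed xy))
  where
  xy-removed : ∀ {b} → T b → indicator (b ∧ not ⌊ sameEnds? x y x y ⌋) < indicator b
  xy-removed {true} _ with sameEnds? x y x y
  ... | yes _    = ℕ.≤-refl
  ... | no ¬same = ⊥-elim (¬same (inj₁ (refl , refl)))

module ABPath {n} {G : Graph n} {A B : Subset n} {p : List⁺ (Fin n)} (ab : IsABPath G A B p) where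

  unique : Unique (toList p)
  unique = proj₁ (proj₁ ab)

  linked : Linked (Adj G) (toList p)
  linked = proj₂ (proj₁ ab)

  head∈A : head p ∈ A
  head∈A = proj₁ (proj₂ ab)

  last∈B : last p ∈ B
  last∈B = proj₁ (proj₂ (proj₂ ab))

  only-head∈A : ∀ v → v ∈P p → v ∈ A → v ≡ head p
  only-head∈A = proj₁ (proj₂ (proj₂ (proj₂ ab)))

  only-last∈B : ∀ v → v ∈P p → v ∈ B → v ≡ last p
  only-last∈B = proj₂ (proj₂ (proj₂ (proj₂ ab)))

WalkFromTo : ∀ {n} → Graph n → Subset n → Subset n → List⁺ (Fin n) → Set
WalkFromTo G A B p = Linked (Adj G) (toList p) × head p ∈ A × last p ∈ B

Linkage : ∀ {n} → Graph n → Subset n → Subset n → ℕ → Set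
Linkage {n} G A B k = Σ (Fin k → List⁺ (Fin n)) λ Q →
  (∀ j → IsABPath G A B (Q j)) × (∀ j l → j ≢ l → ∀ x → x ∈P Q j → ¬ (x ∈P Q l))

linkage-⊆ : ∀ {n} {H G : Graph n} {A B k} → H ⊆ᴳ G → Linkage H A B k → Linkage G A B k
linkage-⊆ {H = H} {G} {A} {B} H⊆G (Q , ab , disjoint) = Q , (λ j → lift (ab j)) , disjoint
  where
  lift : ∀ {p} → IsABPath H A B p → IsABPath G A B p
  lift ((uniq , lk) , ends) = (uniq , Linked.map H⊆G lk) , ends

disjoint⇒injective : ∀ {n k} (Q : Fin k → List⁺ (Fin n)) → (∀ j l → j ≢ l → ∀ x → x ∈P Q j → ¬ (x ∈P Q l)) →
  (f : Fin k → Fin n) → (∀ j → f j ∈P Q j) → Injective _≡_ _≡_ f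
disjoint⇒injective Q disjoint f f∈Q {j} {l} fj≡fl with j Fin.≟ l
... | yes j≡l = j≡l
... | no j≢l  = ⊥-elim (disjoint j l j≢l (f j) (f∈Q j) (subst (_∈P Q l) (≡.sym fj≡fl) (f∈Q l)))

-- R plays the part of the vertices reachable from A \ X in G − X; carrying it
-- as a witness makes "X separates A from B" decidable.
record IsSeparatingRegion {n} (G : Graph n) (A B X R : Subset n) : Set where
  field
    covers-A : ∀ a → a ∈ A → a ∈ X ⊎ a ∈ R
    closed   : ∀ u v → u ∈ R → Adj G u v → v ∈ X ⊎ v ∈ R
    avoids-B : ∀ v → v ∈ R → v ∉ B
    avoids-X : ∀ v → v ∈ R → v ∉ X

Separates : ∀ {n} → Graph n → (A B X : Subset n) → Set
Separates {n} G A B X = Σ (Subset n) (IsSeparatingRegion G A B X)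

isSeparatingRegion? : ∀ {n} (G : Graph n) A B X R → Dec (IsSeparatingRegion G A B X R)
isSeparatingRegion? G A B X R = map′ (λ (c , cl , b , x) → record { covers-A = c ; closed = cl ; avoids-B = b ; avoids-X = x })
  (λ r → let open IsSeparatingRegion r in covers-A , closed , avoids-B , avoids-X)
  (Fin.all? (λ a → (a ∈? A) →-dec ((a ∈? X) ⊎-dec (a ∈? R)))
   ×-dec Fin.all? (λ u → Fin.all? λ v → (u ∈? R) →-dec (T? (edge G u v) →-dec ((v ∈? X) ⊎-dec (v ∈? R))))
   ×-dec Fin.all? (λ v → (v ∈? R) →-dec ¬? (v ∈? B))
   ×-dec Fin.all? (λ v → (v ∈? R) →-dec ¬? (v ∈? X)))

MengerFor : ∀ {n} → Graph n → Set
MengerFor G = ∀ A B k → (∀ X → Separates G A B X → k ≤ ∣ X ∣) → Linkage G A B k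

separates? : ∀ {n} (G : Graph n) A B X → Dec (Separates G A B X)
separates? G A B X = anySubset? (isSeparatingRegion? G A B X)

module _ {n} {G : Graph n} {A B X R : Subset n} (sep : IsSeparatingRegion G A B X R) where
  open IsSeparatingRegion sep

  walk-from-X∪R-meets-X : ∀ x xs → Linked (Adj G) (x ∷ xs) → x ∈ X ⊎ x ∈ R → end x xs ∈ B →
    ∃ λ v → v ∈ₗ x ∷ xs × v ∈ X
  walk-from-X∪R-meets-X x xs       _         (inj₁ x∈X) _ = x , here refl , x∈X
  walk-from-X∪R-meets-X x []       _         (inj₂ x∈R) x∈B = ⊥-elim (avoids-B x x∈R x∈B)
  walk-from-X∪R-meets-X x (y ∷ ys) (xy ∷ lk) (inj₂ x∈R) end∈B
    with v , v∈ , v∈X ← walk-from-X∪R-meets-X y ys lk (closed x y x∈R xy) end∈B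
    = v , there v∈ , v∈X

  walk-meets-separator : ∀ p → WalkFromTo G A B p → ∃ λ v → v ∈P p × v ∈ X
  walk-meets-separator (x ∷ xs) (lk , x∈A , last∈B) =
    walk-from-X∪R-meets-X x xs lk (covers-A x x∈A) (subst (_∈ B) (last≡end x xs) last∈B)

module _ {n} {H : Graph n} {S R : Subset n} (closed : ∀ u v → u ∈ R → Adj H u v → v ∈ S ⊎ v ∈ R) where

  walk-within-S∪R : ∀ x xs → Unique (x ∷ xs) → Linked (Adj H) (x ∷ xs) → x ∈ S ⊎ x ∈ R →
    (∀ w → w ∈ₗ x ∷ xs → w ∈ S → w ≡ end x xs) → ∀ v → v ∈ₗ x ∷ xs → v ∈ S ⊎ v ∈ R
  walk-within-S∪R x []       _    _         x∈S∪R _        _ (here refl) = x∈S∪R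
  walk-within-S∪R x (y ∷ ys) uniq (xy ∷ lk) x∈S∪R S-at-end v v∈ =
    case v∈
    where
    x∈R : x ∈ R
    x∈R = [ (λ x∈S → ⊥-elim (Unique[x∷xs]⇒x∉xs uniq
                (subst (_∈ₗ y ∷ ys) (≡.sym (S-at-end x (here refl) x∈S)) (end∈ y ys))))
          , id ]′ x∈S∪R
    case : v ∈ₗ x ∷ y ∷ ys → v ∈ S ⊎ v ∈ R
    case (here refl) = inj₂ x∈R
    case (there v∈′) = walk-within-S∪R y ys (AllPairs.tail uniq) lk (closed x y x∈R xy)
                         (λ w w∈ → S-at-end w (there w∈)) v v∈′

  trapped-in-R : ∀ u us → Linked (Adj H) (u ∷ us) → u ∈ R → (∀ w → w ∈ₗ us → w ∉ S) → end u us ∈ R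
  trapped-in-R u []       _         u∈R _      = u∈R
  trapped-in-R u (v ∷ vs) (uv ∷ lk) u∈R avoid-S =
    trapped-in-R v vs lk ([ ⊥-elim ∘ avoid-S v (here refl) , id ]′ (closed u v u∈R uv))
                         (λ w w∈ → avoid-S w (there w∈))

  tail-outside-R : ∀ w ws → Linked (Adj H) (w ∷ ws) → (∀ v → v ∈ₗ ws → v ∉ S) → end w ws ∉ R →
    ∀ v → v ∈ₗ ws → v ∉ R
  tail-outside-R w (u ∷ us) (_ ∷ lk) avoid-S end∉R v (here refl) =
    end∉R ∘ λ u∈R → trapped-in-R u us lk u∈R (λ z z∈ → avoid-S z (there z∈))
  tail-outside-R w (u ∷ us) (_ ∷ lk) avoid-S end∉R v (there v∈) =
    tail-outside-R u us lk (λ z z∈ → avoid-S z (there z∈)) end∉R v v∈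

menger-edgeless : ∀ {n} (G : Graph n) → (∀ u v → ¬ Adj G u v) → MengerFor G
menger-edgeless {n} G edgeless A B k bound = Q , Q-ab , Q-disjoint
  where
  A∩B-separates : IsSeparatingRegion G A B (A ∩ B) (A ∩ ∁ B)
  A∩B-separates = record
    { covers-A = λ a a∈A → Sum.map (λ a∈B → x∈p∩q⁺ (a∈A , a∈B)) (λ a∉B → x∈p∩q⁺ (a∈A , x∉p⇒x∈∁p a∉B))
                              (toSum (a ∈? B))
    ; closed   = λ u v _ uv → ⊥-elim (edgeless u v uv)
    ; avoids-B = λ v v∈ → x∈∁p⇒x∉p (proj₂ (x∈p∩q⁻ A (∁ B) v∈))
    ; avoids-X = λ v v∈ v∈A∩B → x∈∁p⇒x∉p (proj₂ (x∈p∩q⁻ A (∁ B) v∈)) (proj₂ (x∈p∩q⁻ A B v∈A∩B))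
    }
  k≤∣A∩B∣ : k ≤ ∣ A ∩ B ∣
  k≤∣A∩B∣ = bound (A ∩ B) (A ∩ ∁ B , A∩B-separates)
  f : Fin k → Fin n
  f i = proj₁ (enumerate (A ∩ B)) (inject≤ i k≤∣A∩B∣)
  f∈A∩B : ∀ i → f i ∈ A ∩ B
  f∈A∩B i = proj₂ (proj₂ (enumerate (A ∩ B))) _
  Q : Fin k → List⁺ (Fin n)
  Q i = f i ∷ []
  Q-ab : ∀ i → IsABPath G A B (Q i)
  Q-ab i = (([] ∷ []) , [-]) , proj₁ (x∈p∩q⁻ A B (f∈A∩B i)) , proj₂ (x∈p∩q⁻ A B (f∈A∩B i))
         , (λ { _ (here refl) _ → refl }) , (λ { _ (here refl) _ → refl })
  Q-disjoint : ∀ i j → i ≢ j → ∀ v → v ∈P Q i → ¬ (v ∈P Q j)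
  Q-disjoint i j i≢j _ (here refl) (here fi≡fj) =
    i≢j (Fin.inject≤-injective k≤∣A∩B∣ k≤∣A∩B∣ i j (proj₁ (proj₂ (enumerate (A ∩ B))) fi≡fj))

module _ {n} (G : Graph n) (x y : Fin n) {A B S R : Subset n}
  (sep : IsSeparatingRegion (removeEdge G x y) A B S R) where
  open IsSeparatingRegion sep

  restore-edge : (x ∈ R → y ∈ S ⊎ y ∈ R) → (y ∈ R → x ∈ S ⊎ x ∈ R) → IsSeparatingRegion G A B S R
  restore-edge x-closed y-closed = record
    { covers-A = covers-A ; closed = closedᴳ ; avoids-B = avoids-B ; avoids-X = avoids-X }
    where
    closedᴳ : ∀ u v → u ∈ R → Adj G u v → v ∈ S ⊎ v ∈ R
    closedᴳ u v u∈R uv with adj⇒adj-removeEdge⊎sameEnds G x y uv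
    ... | inj₁ uv′                = closed u v u∈R uv′
    ... | inj₂ (inj₁ (refl , refl)) = x-closed u∈R
    ... | inj₂ (inj₂ (refl , refl)) = y-closed u∈R

  separation-removeEdge : IsSeparatingRegion G A B S R ⊎ (y ∈ R × x ∉ R × x ∉ S) ⊎ (x ∈ R × y ∉ R × y ∉ S)
  separation-removeEdge with y ∈? R | x ∈? R | x ∈? S | y ∈? S
  ... | yes y∈R | yes x∈R | _       | _       = inj₁ (restore-edge (λ _ → inj₂ y∈R) (λ _ → inj₂ x∈R))
  ... | yes _   | no x∉R  | yes x∈S | _       = inj₁ (restore-edge (⊥-elim ∘ x∉R) (λ _ → inj₁ x∈S))
  ... | yes y∈R | no x∉R  | no x∉S  | _       = inj₂ (inj₁ (y∈R , x∉R , x∉S))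
  ... | no y∉R  | yes _   | _       | yes y∈S = inj₁ (restore-edge (λ _ → inj₁ y∈S) (⊥-elim ∘ y∉R))
  ... | no y∉R  | yes x∈R | _       | no y∉S  = inj₂ (inj₂ (x∈R , y∉R , y∉S))
  ... | no y∉R  | no x∉R  | _       | _       = inj₁ (restore-edge (⊥-elim ∘ x∉R) (⊥-elim ∘ y∉R))

module EdgeStep {n} {G H : Graph n} {x y : Fin n}
  (H⊆G : H ⊆ᴳ G)
  (G⊆H+xy : ∀ {u v} → Adj G u v → Adj H u v ⊎ SameEnds u v x y)
  (yx : Adj G y x)
  {A B S R : Subset n} (sep : IsSeparatingRegion H A B S R)
  (y∈R : y ∈ R) (x∉R : x ∉ R) (x∉S : x ∉ S)
  {k : ℕ} (∣S∣<k : ∣ S ∣ < k)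
  (bound : ∀ X → Separates G A B X → k ≤ ∣ X ∣)
  (menger-H : ∀ A′ B′ → (∀ X → Separates H A′ B′ X → k ≤ ∣ X ∣) → Linkage H A′ B′ k)
  where

  open IsSeparatingRegion sep

  S+x S+y : Subset n
  S+x = S ∪ ⁅ x ⁆
  S+y = S ∪ ⁅ y ⁆

  S⊆S+ : ∀ {z v} → v ∈ S → v ∈ S ∪ ⁅ z ⁆
  S⊆S+ v∈S = x∈p∪q⁺ (inj₁ v∈S)

  z∈S+z : ∀ z → z ∈ S ∪ ⁅ z ⁆
  z∈S+z z = x∈p∪q⁺ (inj₂ (x∈⁅x⁆ z))

  ∣S+z∣≤k : ∀ z → ∣ S ∪ ⁅ z ⁆ ∣ ≤ k
  ∣S+z∣≤k z = ℕ.≤-trans (∣p∪q∣≤∣p∣+∣q∣ S ⁅ z ⁆)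
    (subst (_≤ k) (≡.trans (ℕ.+-comm 1 ∣ S ∣) (cong (∣ S ∣ +_) (≡.sym (∣⁅x⁆∣≡1 z)))) ∣S∣<k)

  separates-S+y⇒separates : ∀ T → Separates H A S+y T → Separates G A B T
  separates-S+y⇒separates T (Rᵀ , sepᵀ) = Rᵀ ∩ R , record
    { covers-A = coversᴳ
    ; closed   = closedᴳ
    ; avoids-B = λ v v∈ → avoids-B v (proj₂ (x∈p∩q⁻ Rᵀ R v∈))
    ; avoids-X = λ v v∈ → T.avoids-X v (proj₁ (x∈p∩q⁻ Rᵀ R v∈))
    }
    where
    module T = IsSeparatingRegion sepᵀ
    coversᴳ : ∀ a → a ∈ A → a ∈ T ⊎ a ∈ Rᵀ ∩ R
    coversᴳ a a∈A with T.covers-A a a∈A | covers-A a a∈A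
    ... | inj₁ a∈T  | _        = inj₁ a∈T
    ... | inj₂ a∈Rᵀ | inj₁ a∈S = ⊥-elim (T.avoids-B a a∈Rᵀ (S⊆S+ a∈S))
    ... | inj₂ a∈Rᵀ | inj₂ a∈R = inj₂ (x∈p∩q⁺ (a∈Rᵀ , a∈R))
    closedᴳ : ∀ u v → u ∈ Rᵀ ∩ R → Adj G u v → v ∈ T ⊎ v ∈ Rᵀ ∩ R
    closedᴳ u v u∈ uv with x∈p∩q⁻ Rᵀ R u∈ | G⊆H+xy uv
    ... | _ , u∈R    | inj₂ (inj₁ (refl , _)) = ⊥-elim (x∉R u∈R)
    ... | u∈Rᵀ , _   | inj₂ (inj₂ (refl , _)) = ⊥-elim (T.avoids-B u u∈Rᵀ (z∈S+z y))
    ... | u∈Rᵀ , u∈R | inj₁ uvᴴ with T.closed u v u∈Rᵀ uvᴴ | closed u v u∈R uvᴴ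
    ...   | inj₁ v∈T  | _        = inj₁ v∈T
    ...   | inj₂ v∈Rᵀ | inj₁ v∈S = ⊥-elim (T.avoids-B v v∈Rᵀ (S⊆S+ v∈S))
    ...   | inj₂ v∈Rᵀ | inj₂ v∈R = inj₂ (x∈p∩q⁺ (v∈Rᵀ , v∈R))

  separates-S+x⇒separates : ∀ T → Separates H S+x B T → Separates G A B T
  separates-S+x⇒separates T (Rᵀ , sepᵀ) = region , record
    { covers-A = coversᴳ
    ; closed   = closedᴳ
    ; avoids-B = λ v v∈ → [ avoids-B v , T.avoids-B v ]′ (x∈p∪q⁻ R Rᵀ (proj₁ (x∈p∩q⁻ (R ∪ Rᵀ) (∁ T) v∈)))
    ; avoids-X = λ v v∈ → x∈∁p⇒x∉p (proj₂ (x∈p∩q⁻ (R ∪ Rᵀ) (∁ T) v∈))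
    }
    where
    module T = IsSeparatingRegion sepᵀ
    region : Subset n
    region = (R ∪ Rᵀ) ∩ ∁ T
    into-region : ∀ {v} → v ∉ T → v ∈ R ⊎ v ∈ Rᵀ → v ∈ region
    into-region v∉T v∈ = x∈p∩q⁺ (x∈p∪q⁺ v∈ , x∉p⇒x∈∁p v∉T)
    S+x⊆region : ∀ {v} → v ∉ T → v ∈ S+x → v ∈ region
    S+x⊆region {v} v∉T v∈ = into-region v∉T (inj₂ ([ ⊥-elim ∘ v∉T , id ]′ (T.covers-A v v∈)))
    from-R : ∀ {v} → v ∉ T → v ∈ S ⊎ v ∈ R → v ∈ region
    from-R v∉T = [ S+x⊆region v∉T ∘ S⊆S+ , into-region v∉T ∘ inj₁ ]′
    coversᴳ : ∀ a → a ∈ A → a ∈ T ⊎ a ∈ region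
    coversᴳ a a∈A with a ∈? T
    ... | yes a∈T = inj₁ a∈T
    ... | no a∉T  = inj₂ (from-R a∉T (covers-A a a∈A))
    step : ∀ u v → u ∈ R ⊎ u ∈ Rᵀ → Adj G u v → v ∉ T → v ∈ region
    step u v u∈ uv v∉T with G⊆H+xy uv | u∈
    ... | inj₂ (inj₁ (_ , refl)) | _      = into-region v∉T (inj₁ y∈R)
    ... | inj₂ (inj₂ (_ , refl)) | _      = S+x⊆region v∉T (z∈S+z x)
    ... | inj₁ uvᴴ | inj₁ u∈R  = from-R v∉T (closed u v u∈R uvᴴ)
    ... | inj₁ uvᴴ | inj₂ u∈Rᵀ = into-region v∉T (inj₂ ([ ⊥-elim ∘ v∉T , id ]′ (T.closed u v u∈Rᵀ uvᴴ)))
    closedᴳ : ∀ u v → u ∈ region → Adj G u v → v ∈ T ⊎ v ∈ region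
    closedᴳ u v u∈ uv with v ∈? T
    ... | yes v∈T = inj₁ v∈T
    ... | no v∉T  = inj₂ (step u v (x∈p∪q⁻ R Rᵀ (proj₁ (x∈p∩q⁻ (R ∪ Rᵀ) (∁ T) u∈))) uv v∉T)

  into-S+y : Linkage H A S+y k
  into-S+y = menger-H A S+y λ T sepᵀ → bound T (separates-S+y⇒separates T sepᵀ)

  out-of-S+x : Linkage H S+x B k
  out-of-S+x = menger-H S+x B λ T sepᵀ → bound T (separates-S+x⇒separates T sepᵀ)

  P Q : Fin k → List⁺ (Fin n)
  P = proj₁ into-S+y
  Q = proj₁ out-of-S+x

  module Pᵢ (i : Fin k) = ABPath {G = H} {A} {S+y} {P i} (proj₁ (proj₂ into-S+y) i)
  module Qⱼ (j : Fin k) = ABPath {G = H} {S+x} {B} {Q j} (proj₁ (proj₂ out-of-S+x) j)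

  P-disjoint : ∀ i i′ → i ≢ i′ → ∀ v → v ∈P P i → ¬ (v ∈P P i′)
  P-disjoint = proj₂ (proj₂ into-S+y)

  Q-disjoint : ∀ j j′ → j ≢ j′ → ∀ v → v ∈P Q j → ¬ (v ∈P Q j′)
  Q-disjoint = proj₂ (proj₂ out-of-S+x)

  last-P-injective : Injective _≡_ _≡_ (last ∘ P)
  last-P-injective = disjoint⇒injective P P-disjoint (last ∘ P) (last∈P ∘ P)

  Q-starts-at : ∀ {v} → v ∈ S+x → ∃ λ j → head (Q j) ≡ v
  Q-starts-at = injective⇒onto S+x (head ∘ Q)
    (disjoint⇒injective Q Q-disjoint (head ∘ Q) (λ _ → here refl)) Qⱼ.head∈A (∣S+z∣≤k x)

  P-within-S∪R : ∀ i v → v ∈P P i → v ∈ S ⊎ v ∈ R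
  P-within-S∪R i = walk-within-S∪R {H = H} closed (head (P i)) (tail (P i)) (Pᵢ.unique i) (Pᵢ.linked i)
    (covers-A _ (Pᵢ.head∈A i))
    λ w w∈ w∈S → ≡.trans (Pᵢ.only-last∈B i w w∈ (S⊆S+ w∈S)) (last≡end (head (P i)) (tail (P i)))

  Q-tail-outside-S∪R : ∀ j w → w ∈ₗ tail (Q j) → ¬ (w ∈ S ⊎ w ∈ R)
  Q-tail-outside-S∪R j w w∈ = [ tail∉S w w∈ , tail-outside-R {H = H} closed (head (Q j)) (tail (Q j)) (Qⱼ.linked j) tail∉S end∉R w w∈ ]′
    where
    tail∉S : ∀ v → v ∈ₗ tail (Q j) → v ∉ S
    tail∉S v v∈ v∈S = Unique[x∷xs]⇒x∉xs (Qⱼ.unique j)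
      (subst (_∈ₗ tail (Q j)) (Qⱼ.only-head∈A j v (there v∈) (S⊆S+ v∈S)) v∈)
    end∉R : end (head (Q j)) (tail (Q j)) ∉ R
    end∉R end∈R = avoids-B _ end∈R (subst (_∈ B) (last≡end (head (Q j)) (tail (Q j))) (Qⱼ.last∈B j))

  -- The part of some Q j that P i is extended by: its tail when P i ends in S,
  -- all of it (through the edge yx) when P i ends in y.
  record Continuation (i : Fin k) : Set where
    field
      j            : Fin k
      rest         : List (Fin n)
      rest⊆Q       : ∀ w → w ∈ₗ rest → w ∈P Q j
      rest-outside : ∀ w → w ∈ₗ rest → ¬ (w ∈ S ⊎ w ∈ R)
      rest-unique  : Unique rest
      rest-linked  : Linked (Adj G) (last (P i) ∷ rest)
      rest-end     : end (last (P i)) rest ≡ last (Q j)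
      junction     : (last (P i) ∈ S × head (Q j) ≡ last (P i)) ⊎ (last (P i) ≡ y × head (Q j) ≡ x)

  continuation : ∀ i → Continuation i
  continuation i with x∈p∪q⁻ S ⁅ y ⁆ (Pᵢ.last∈B i)
  ... | inj₁ end∈S with j , Qj-starts ← Q-starts-at (S⊆S+ end∈S) = record
    { j            = j
    ; rest         = tail (Q j)
    ; rest⊆Q       = λ _ → there
    ; rest-outside = Q-tail-outside-S∪R j
    ; rest-unique  = AllPairs.tail (Qⱼ.unique j)
    ; rest-linked  = subst (λ z → Linked (Adj G) (z ∷ tail (Q j))) Qj-starts (Linked.map H⊆G (Qⱼ.linked j))
    ; rest-end     = subst (λ z → end z (tail (Q j)) ≡ last (Q j)) Qj-starts (≡.sym (last≡end (head (Q j)) (tail (Q j))))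
    ; junction     = inj₁ (end∈S , Qj-starts)
    }
  ... | inj₂ end∈⁅y⁆ with j , Qj-starts ← Q-starts-at (z∈S+z x) = record
    { j            = j
    ; rest         = toList (Q j)
    ; rest⊆Q       = λ _ → id
    ; rest-outside = Q-outside-S∪R
    ; rest-unique  = Qⱼ.unique j
    ; rest-linked  = subst₂ (Adj G) (≡.sym end≡y) (≡.sym Qj-starts) yx ∷ Linked.map H⊆G (Qⱼ.linked j)
    ; rest-end     = ≡.sym (last≡end (head (Q j)) (tail (Q j)))
    ; junction     = inj₂ (end≡y , Qj-starts)
    }
    where
    end≡y : last (P i) ≡ y
    end≡y = x∈⁅y⁆⇒x≡y y end∈⁅y⁆
    Q-outside-S∪R : ∀ w → w ∈ₗ toList (Q j) → ¬ (w ∈ S ⊎ w ∈ R)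
    Q-outside-S∪R w (here w≡start) = subst (λ z → ¬ (z ∈ S ⊎ z ∈ R)) (≡.sym (≡.trans w≡start Qj-starts)) [ x∉S , x∉R ]′
    Q-outside-S∪R w (there w∈)     = Q-tail-outside-S∪R j w w∈

  junction-determines-end : ∀ {a a′ b b′} → b ≡ b′ →
    (a ∈ S × b ≡ a) ⊎ (a ≡ y × b ≡ x) → (a′ ∈ S × b′ ≡ a′) ⊎ (a′ ≡ y × b′ ≡ x) → a ≡ a′
  junction-determines-end refl (inj₁ (_ , refl))   (inj₁ (_ , refl))   = refl
  junction-determines-end refl (inj₂ (refl , _))   (inj₂ (refl , _))   = refl
  junction-determines-end refl (inj₁ (a∈S , refl)) (inj₂ (_ , refl))   = ⊥-elim (x∉S a∈S)
  junction-determines-end refl (inj₂ (_ , refl))   (inj₁ (a∈S , refl)) = ⊥-elim (x∉S a∈S)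

  continuation-injective : ∀ {i i′} → Continuation.j (continuation i) ≡ Continuation.j (continuation i′) → i ≡ i′
  continuation-injective {i} {i′} j≡j′ = last-P-injective
    (junction-determines-end (cong (head ∘ Q) j≡j′)
      (Continuation.junction (continuation i)) (Continuation.junction (continuation i′)))

  glued : Fin k → List⁺ (Fin n)
  glued i = P i ⁺++ Continuation.rest (continuation i)

  glued-ab : ∀ i → IsABPath G A B (glued i)
  glued-ab i = (++⁺ (Pᵢ.unique i) rest-unique P∩rest≡∅ , linked) , Pᵢ.head∈A i
             , subst (_∈ B) (≡.sym glued-last) (Qⱼ.last∈B j) , only-head∈A , only-last∈B
    where
    open Continuation (continuation i)
    h : Fin n
    h = head (P i)
    t : List (Fin n)
    t = tail (P i)
    P∩rest≡∅ : ∀ {v} → ¬ (v ∈ₗ h ∷ t × v ∈ₗ rest)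
    P∩rest≡∅ (v∈P , v∈rest) = rest-outside _ v∈rest (P-within-S∪R i _ v∈P)
    linked : Linked (Adj G) (h ∷ t ++ rest)
    linked = Linked-++ h t rest (Linked.map H⊆G (Pᵢ.linked i))
               (subst (λ z → Linked (Adj G) (z ∷ rest)) (last≡end h t) rest-linked)
    glued-last : last (glued i) ≡ last (Q j)
    glued-last = begin
      last (glued i)          ≡⟨ last≡end h (t ++ rest) ⟩
      end h (t ++ rest)       ≡⟨ end-++ h t rest ⟩
      end (end h t) rest      ≡⟨ cong (λ z → end z rest) (≡.sym (last≡end h t)) ⟩
      end (last (P i)) rest   ≡⟨ rest-end ⟩
      last (Q j)              ∎
      where open ≡.≡-Reasoning
    last-P∈B⇒∈Q : last (P i) ∈ B → last (P i) ∈P Q j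
    last-P∈B⇒∈Q end∈B with junction
    ... | inj₁ (_ , Qj-starts)  = subst (_∈P Q j) Qj-starts (here refl)
    ... | inj₂ (end≡y , _)      = ⊥-elim (avoids-B y y∈R (subst (_∈ B) end≡y end∈B))
    only-head∈A : ∀ v → v ∈P glued i → v ∈ A → v ≡ h
    only-head∈A v v∈ v∈A with ∈-++⁻ (h ∷ t) v∈
    ... | inj₁ v∈P    = Pᵢ.only-head∈A i v v∈P v∈A
    ... | inj₂ v∈rest = ⊥-elim (rest-outside v v∈rest (covers-A v v∈A))
    only-last∈B : ∀ v → v ∈P glued i → v ∈ B → v ≡ last (glued i)
    only-last∈B v v∈ v∈B with ∈-++⁻ (h ∷ t) v∈
    ... | inj₂ v∈rest = ≡.trans (Qⱼ.only-last∈B j v (rest⊆Q v v∈rest) v∈B) (≡.sym glued-last)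
    ... | inj₁ v∈P with P-within-S∪R i v v∈P
    ...   | inj₂ v∈R = ⊥-elim (avoids-B v v∈R v∈B)
    ...   | inj₁ v∈S with Pᵢ.only-last∈B i v v∈P (S⊆S+ v∈S)
    ...     | refl = ≡.trans (Qⱼ.only-last∈B j v (last-P∈B⇒∈Q v∈B) v∈B) (≡.sym glued-last)

  glued-disjoint : ∀ i i′ → i ≢ i′ → ∀ v → v ∈P glued i → ¬ (v ∈P glued i′)
  glued-disjoint i i′ i≢i′ v v∈ v∈′ with ∈-++⁻ (toList (P i)) v∈ | ∈-++⁻ (toList (P i′)) v∈′
  ... | inj₁ v∈P | inj₁ v∈P′    = P-disjoint i i′ i≢i′ v v∈P v∈P′
  ... | inj₁ v∈P | inj₂ v∈rest′ = Continuation.rest-outside (continuation i′) v v∈rest′ (P-within-S∪R i v v∈P)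
  ... | inj₂ v∈rest | inj₁ v∈P′ = Continuation.rest-outside (continuation i) v v∈rest (P-within-S∪R i′ v v∈P′)
  ... | inj₂ v∈rest | inj₂ v∈rest′ =
    Q-disjoint _ _ (i≢i′ ∘ continuation-injective) v
      (Continuation.rest⊆Q (continuation i) v v∈rest) (Continuation.rest⊆Q (continuation i′) v v∈rest′)

  linkage : Linkage G A B k
  linkage = glued , glued-ab , glued-disjoint

menger-removeEdge : ∀ {n} (G : Graph n) x y → Adj G x y → MengerFor (removeEdge G x y) → MengerFor G
menger-removeEdge G x y xy menger-H A B k bound
  with anySubset? (λ S → (suc ∣ S ∣ ≤? k) ×-dec separates? (removeEdge G x y) A B S)
... | no no-small-separator = linkage-⊆ {H = removeEdge G x y} {G} (removeEdge-⊆ G x y) (menger-H A B k bound-H)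
  where
  bound-H : ∀ X → Separates (removeEdge G x y) A B X → k ≤ ∣ X ∣
  bound-H X sep = ℕ.≮⇒≥ λ ∣X∣<k → no-small-separator (X , ∣X∣<k , sep)
... | yes (S , ∣S∣<k , R , sep) with separation-removeEdge G x y sep
...   | inj₁ sepᴳ = ⊥-elim (ℕ.<⇒≱ ∣S∣<k (bound S (R , sepᴳ)))
...   | inj₂ (inj₁ (y∈R , x∉R , x∉S)) =
  EdgeStep.linkage {G = G} {removeEdge G x y} {x} {y} (removeEdge-⊆ G x y) (adj⇒adj-removeEdge⊎sameEnds G x y)
    (subst T (Graph.sym G x y) xy) sep y∈R x∉R x∉S ∣S∣<k bound (λ A′ B′ → menger-H A′ B′ k)
...   | inj₂ (inj₂ (x∈R , y∉R , y∉S)) =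
  EdgeStep.linkage {G = G} {removeEdge G x y} {y} {x} (removeEdge-⊆ G x y) (Sum.map₂ Sum.swap ∘ adj⇒adj-removeEdge⊎sameEnds G x y)
    xy sep x∈R y∉R y∉S ∣S∣<k bound (λ A′ B′ → menger-H A′ B′ k)

menger-≤ : ∀ {n} m (G : Graph n) → edgeCount G ≤ m → MengerFor G
menger-≤ m G ∣E∣≤m with Fin.any? (λ u → Fin.any? λ v → T? (edge G u v))
... | no edgeless = menger-edgeless G (λ u v uv → edgeless (u , v , uv))
menger-≤ zero G ∣E∣≤0 | yes (x , y , xy) = ⊥-elim (ℕ.n≮0 (ℕ.<-≤-trans (edgeCount-removeEdge G x y xy) ∣E∣≤0))
menger-≤ (suc m) G ∣E∣≤1+m | yes (x , y , xy) = menger-removeEdge G x y xy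
  (menger-≤ m (removeEdge G x y) (ℕ.≤-pred (ℕ.≤-trans (edgeCount-removeEdge G x y xy) ∣E∣≤1+m)))

menger : ∀ {n} (G : Graph n) → MengerFor G
menger G = menger-≤ (edgeCount G) G ℕ.≤-refl

-- Families of paths sharing each vertex at most twice

NoVertexOnThree : ∀ {I : Set} {n} → (I → List⁺ (Fin n)) → Set
NoVertexOnThree P = ∀ {i j l} → i ≢ j → j ≢ l → i ≢ l → ∀ v → v ∈P P i → v ∈P P j → v ∈P P l → ⊥

splitAt-injective : ∀ m n → Injective _≡_ _≡_ (splitAt m {n})
splitAt-injective m n {i} {j} eq =
  ≡.trans (≡.sym (Fin.join-splitAt m n i)) (≡.trans (cong (join m n) eq) (Fin.join-splitAt m n j))

noVertexOnThree-∘ : ∀ {I J : Set} {n} (P : I → List⁺ (Fin n)) (f : J → I) →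
  Injective _≡_ _≡_ f → NoVertexOnThree P → NoVertexOnThree (P ∘ f)
noVertexOnThree-∘ P f f-injective three i≢j j≢l i≢l = three (i≢j ∘ f-injective) (j≢l ∘ f-injective) (i≢l ∘ f-injective)

separator-size : ∀ {n m} {G : Graph n} {A B X : Subset n} (W : Fin m → List⁺ (Fin n)) →
  (∀ i → WalkFromTo G A B (W i)) → NoVertexOnThree W → Separates G A B X → m ≤ ∣ X ∣ + ∣ X ∣
separator-size {X = X} W walk three (_ , sep) =
  atMostTwoToOne⇒≤2∣p∣ X hit two (λ i → proj₂ (proj₂ (meets i)))
  where
  meets : ∀ i → ∃ λ v → v ∈P W i × v ∈ X
  meets i = walk-meets-separator sep (W i) (walk i)
  hit : Fin _ → Fin _
  hit = proj₁ ∘ meets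
  two : AtMostTwoToOne hit
  two {i} {j} {l} i≢j j≢l i≢l hi≡hj hj≡hl = three i≢j j≢l i≢l (hit j)
    (subst (_∈P W i) hi≡hj (proj₁ (proj₂ (meets i))))
    (proj₁ (proj₂ (meets j)))
    (subst (_∈P W l) (≡.sym hj≡hl) (proj₁ (proj₂ (meets l))))

¬three-distinct-in-pair : {I : Set} {a b c p q : I} → a ≢ b → b ≢ c → a ≢ c →
  a ≡ p ⊎ a ≡ q → b ≡ p ⊎ b ≡ q → c ≡ p ⊎ c ≡ q → ⊥
¬three-distinct-in-pair a≢b b≢c a≢c (inj₁ refl) (inj₁ refl) _           = a≢b refl
¬three-distinct-in-pair a≢b b≢c a≢c (inj₂ refl) (inj₂ refl) _           = a≢b refl
¬three-distinct-in-pair a≢b b≢c a≢c (inj₁ refl) _           (inj₁ refl) = a≢c refl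
¬three-distinct-in-pair a≢b b≢c a≢c (inj₂ refl) _           (inj₂ refl) = a≢c refl
¬three-distinct-in-pair a≢b b≢c a≢c _           (inj₁ refl) (inj₁ refl) = b≢c refl
¬three-distinct-in-pair a≢b b≢c a≢c _           (inj₂ refl) (inj₂ refl) = b≢c refl

module GoodFamilyFacts {n} {G : Graph n} {A C B : Subset n} (F : GoodFamily G A C B) where

  paths : Fin (2 * ∣ A ∣) → List⁺ (Fin n)
  paths = proj₁ F

  walk : ∀ i → WalkFromTo G A B (paths i)
  walk i = let (((_ , lk) , head∈A , last∈B , _) , _) = proj₁ (proj₂ F) i in lk , head∈A , last∈B

  avoids-C : ∀ {i} v → v ∈P paths i → v ∉ C
  avoids-C {i} = proj₂ (proj₁ (proj₂ F) i)

  shared⇒∈A : ∀ {i j} → i ≢ j → ∀ v → v ∈P paths i → v ∈P paths j → v ∈ A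
  shared⇒∈A {i} {j} = proj₁ (proj₂ (proj₂ F)) i j

  noVertexOnThree : NoVertexOnThree paths
  noVertexOnThree {i} {j} {l} i≢j j≢l i≢l v v∈i v∈j v∈l
    with _ , _ , _ , _ , _ , only-two ← proj₂ (proj₂ (proj₂ F)) v (shared⇒∈A i≢j v v∈i v∈j)
    = ¬three-distinct-in-pair i≢j j≢l i≢l (only-two i v∈i) (only-two j v∈j) (only-two l v∈l)

noVertexOnThree-⊎ : ∀ {n} {G : Graph n} {A₁ A₂ B : Subset n} (F₁ : GoodFamily G A₁ A₂ B) (F₂ : GoodFamily G A₂ A₁ B) →
  NoVertexOnThree [ proj₁ F₁ , proj₁ F₂ ]′
noVertexOnThree-⊎ {G = G} {A₁} {A₂} {B} F₁ F₂ = three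
  where
  module F₁ = GoodFamilyFacts {G = G} {A₁} {A₂} {B} F₁
  module F₂ = GoodFamilyFacts {G = G} {A₂} {A₁} {B} F₂
  three : NoVertexOnThree [ F₁.paths , F₂.paths ]′
  three {inj₁ i} {inj₁ j} {inj₁ l} i≢j j≢l i≢l =
    F₁.noVertexOnThree (i≢j ∘ cong inj₁) (j≢l ∘ cong inj₁) (i≢l ∘ cong inj₁)
  three {inj₂ i} {inj₂ j} {inj₂ l} i≢j j≢l i≢l =
    F₂.noVertexOnThree (i≢j ∘ cong inj₂) (j≢l ∘ cong inj₂) (i≢l ∘ cong inj₂)
  three {inj₁ i} {inj₁ j} {inj₂ l} i≢j _ _ v v∈i v∈j v∈l = F₂.avoids-C v v∈l (F₁.shared⇒∈A (i≢j ∘ cong inj₁) v v∈i v∈j)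
  three {inj₁ i} {inj₂ j} {inj₁ l} _ _ i≢l v v∈i v∈j v∈l = F₂.avoids-C v v∈j (F₁.shared⇒∈A (i≢l ∘ cong inj₁) v v∈i v∈l)
  three {inj₂ i} {inj₁ j} {inj₁ l} _ j≢l _ v v∈i v∈j v∈l = F₂.avoids-C v v∈i (F₁.shared⇒∈A (j≢l ∘ cong inj₁) v v∈j v∈l)
  three {inj₁ i} {inj₂ j} {inj₂ l} _ j≢l _ v v∈i v∈j v∈l = F₁.avoids-C v v∈i (F₂.shared⇒∈A (j≢l ∘ cong inj₂) v v∈j v∈l)
  three {inj₂ i} {inj₁ j} {inj₂ l} _ _ i≢l v v∈i v∈j v∈l = F₁.avoids-C v v∈j (F₂.shared⇒∈A (i≢l ∘ cong inj₂) v v∈i v∈l)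
  three {inj₂ i} {inj₂ j} {inj₁ l} i≢j _ _ v v∈i v∈j v∈l = F₁.avoids-C v v∈l (F₂.shared⇒∈A (i≢j ∘ cong inj₂) v v∈i v∈j)

lemma5p3 : ∀ {n} (G : Graph n) (A₁ A₂ B : Subset n)
    → Nonempty A₁ → Nonempty A₂ → Nonempty B
    → Disjoint A₁ A₂ → Disjoint A₁ B → Disjoint A₂ B
    → GoodFamily G A₁ A₂ B
    → GoodFamily G A₂ A₁ B
    → Σ (Fin (∣ A₁ ∣ + ∣ A₂ ∣) → List⁺ (Fin n)) λ Q →
        (∀ j → IsABPath G (A₁ ∪ A₂) B (Q j))
        × (∀ j k → j ≢ k → ∀ x → x ∈P Q j → ¬ (x ∈P Q k))
lemma5p3 {n} G A₁ A₂ B _ _ _ _ _ _ F₁ F₂ = menger G (A₁ ∪ A₂) B (∣ A₁ ∣ + ∣ A₂ ∣) separator-large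
  where
  module F₁ = GoodFamilyFacts {G = G} {A₁} {A₂} {B} F₁
  module F₂ = GoodFamilyFacts {G = G} {A₂} {A₁} {B} F₂
  a b : ℕ
  a = 2 * ∣ A₁ ∣
  b = 2 * ∣ A₂ ∣
  W : Fin (a + b) → List⁺ (Fin n)
  W = [ F₁.paths , F₂.paths ]′ ∘ splitAt a
  W-walk : ∀ i → WalkFromTo G (A₁ ∪ A₂) B (W i)
  W-walk i with splitAt a i
  ... | inj₁ i₁ = let (lk , h∈ , l∈) = F₁.walk i₁ in lk , x∈p∪q⁺ (inj₁ h∈) , l∈
  ... | inj₂ i₂ = let (lk , h∈ , l∈) = F₂.walk i₂ in lk , x∈p∪q⁺ (inj₂ h∈) , l∈
  W-noVertexOnThree : NoVertexOnThree W
  W-noVertexOnThree = noVertexOnThree-∘ [ F₁.paths , F₂.paths ]′ (splitAt a) (splitAt-injective a b)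
    (noVertexOnThree-⊎ {G = G} F₁ F₂)
  halve : ∀ {x} → a + b ≤ x + x → ∣ A₁ ∣ + ∣ A₂ ∣ ≤ x
  halve {x} = ℕ.*-cancelˡ-≤ 2 ∘ subst₂ _≤_ (≡.sym (ℕ.*-distribˡ-+ 2 ∣ A₁ ∣ ∣ A₂ ∣)) (cong (x +_) (≡.sym (ℕ.+-identityʳ x)))
  separator-large : ∀ X → Separates G (A₁ ∪ A₂) B X → ∣ A₁ ∣ + ∣ A₂ ∣ ≤ ∣ X ∣
  separator-large X sep = halve (separator-size W W-walk W-noVertexOnThree sep)
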